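{- Let $G$ be a connected graph, $r\ge2$ an integer, and $H=G^r$. Then every isometric path of $H$ contains at most one edge that belongs to $E(G)$.
   Context: $G^r$ is the graph on $V(G)$ in which two distinct vertices are adjacent iff their distance in $G$ is at most $r$; thus $E(G)\subseteq E(H)$. An isometric path is a shortest path between its end-vertices. -}

module Defs where

open import Data.Nat using (ℕ; zero; suc; _≤_)
open import Data.Fin using (Fin; inject₁; fromℕ) renaming (zero to fzero; suc to fsuc)
open import Data.Product using (Σ; ∃-syntax; _×_; _,_)
open import Relation.Nullary using (¬_)
open import Relation.Binary.PropositionalEquality using (_≡_; _≢_)
open import Level using (Level; suc; _⊔_) renaming (zero to lzero)

record Graph (n : ℕ) : Set₁ where
  field
    Adj     : Fin n → Fin n → Set
    sym     : ∀ {u v} → Adj u v → Adj v u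
    irrefl  : ∀ {v} → ¬ Adj v v
open Graph public

data Walk {n : ℕ} (G : Graph n) : Fin n → Fin n → ℕ → Set where
  nil  : ∀ v → Walk G v v 0
  cons : ∀ {u v w k} → Adj G u v → Walk G v w k → Walk G u w (ℕ.suc k)

DistLe : ∀ {n} → Graph n → Fin n → Fin n → ℕ → Set
DistLe G u v r = ∃[ k ] (k ≤ r × Walk G u v k)

Connected : ∀ {n} → Graph n → Set
Connected G = ∀ u v → ∃[ k ] Walk G u v k

power : ∀ {n} → Graph n → ℕ → Graph n
power G r = record
  { Adj    = λ u v → (u ≢ v) × DistLe G u v r
  ; sym    = λ { (u≢v , k , k≤r , w) → (λ e → u≢v (Relation.Binary.PropositionalEquality.sym e)) , k , k≤r , rev w }
  ; irrefl = λ { (v≢v , _) → v≢v Relation.Binary.PropositionalEquality.refl }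
  }
  where
  snoc : ∀ {u v w k} → Walk G u v k → Adj G v w → Walk G u w (ℕ.suc k)
  snoc (nil _) a = cons a (nil _)
  snoc (cons a w) b = cons a (snoc w b)
  rev : ∀ {u v k} → Walk G u v k → Walk G v u k
  rev (nil v) = nil v
  rev (cons a w) = snoc (rev w) (Graph.sym G a)

record IsPath {n : ℕ} (G : Graph n) (ℓ : ℕ) (p : Fin (ℕ.suc ℓ) → Fin n) : Set where
  field
    injective : ∀ i j → p i ≡ p j → i ≡ j
    adjacent  : ∀ (i : Fin ℓ) → Adj G (p (inject₁ i)) (p (fsuc i))
open IsPath public

record IsIsometricPath {n : ℕ} (G : Graph n) (ℓ : ℕ) (p : Fin (ℕ.suc ℓ) → Fin n) : Set where
  field
    isPath   : IsPath G ℓ p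
    shortest : ∀ k → Walk G (p fzero) (p (fromℕ ℓ)) k → ℓ ≤ k
open IsIsometricPath public

-- Suppose the isometric path p₀ … p_ℓ of H = G^r had two G-edges p_a p_{a+1} and
-- p_b p_{b+1} with a < b. Each of the b − a − 1 H-edges strictly between them spans
-- at most r edges of G, so dist_G(p_a, p_{b+1}) ≤ (b − a − 1) r + 2 ≤ (b − a) r
-- because r ≥ 2. Cutting a G-walk of that length into pieces of length ≤ r joins
-- p_a to p_{b+1} by at most b − a edges of H, whereas the subpath between them has
-- b − a + 1 edges; this contradicts that subpaths of isometric paths are isometric.
module Submission where

open import Defs
open import Data.Nat using (ℕ; zero; suc; _+_; _*_; _∸_; _≤_; _<_; z≤n; s≤s; _≤?_)
open import Data.Nat.Properties
open import Data.Nat.DivMod using (_mod_; m<n⇒m%n≡m)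
open import Data.Fin using (Fin; inject₁; toℕ; fromℕ; fromℕ<)
  renaming (zero to fzero; suc to fsuc; _≟_ to _≟ᶠ_)
open import Data.Fin.Properties using (toℕ-injective; toℕ<n; toℕ-fromℕ; toℕ-fromℕ<; toℕ-inject₁)
open import Data.Product using (∃-syntax; _×_; _,_)
open import Data.Empty using (⊥; ⊥-elim)
open import Relation.Nullary using (yes; no)
open import Relation.Binary.Definitions using (tri<; tri≈; tri>)
open import Relation.Binary.PropositionalEquality
  using (_≡_; refl; trans; cong; subst; subst₂; module ≡-Reasoning) renaming (sym to ≡-sym)

module _ {n : ℕ} {G : Graph n} where

  _++ʷ_ : ∀ {u v w k m} → Walk G u v k → Walk G v w m → Walk G u w (k + m)
  nil _    ++ʷ w = w
  cons a w ++ʷ w′ = cons a (w ++ʷ w′)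

  splitWalk : ∀ s {t u v} → Walk G u v (s + t) → ∃[ x ] (Walk G u x s × Walk G x v t)
  splitWalk zero    {u = u} w = u , nil u , w
  splitWalk (suc s) (cons a w) with splitWalk s w
  ... | x , w₁ , w₂ = x , cons a w₁ , w₂

module _ {n : ℕ} (G : Graph n) (r : ℕ) where

  private
    H : Graph n
    H = power G r

  power-walk⇒walk : ∀ {u v t} → Walk H u v t → ∃[ k ] (k ≤ t * r × Walk G u v k)
  power-walk⇒walk (nil u) = 0 , z≤n , nil u
  power-walk⇒walk (cons (_ , k₀ , k₀≤r , w₀) W) with power-walk⇒walk W
  ... | k₁ , k₁≤ , w₁ = k₀ + k₁ , +-mono-≤ k₀≤r k₁≤ , w₀ ++ʷ w₁

  prepend-hop : ∀ {m u x v s} → s ≤ r → Walk G u x s →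
                ∃[ t ] (t ≤ m × Walk H x v t) → ∃[ t ] (t ≤ suc m × Walk H u v t)
  prepend-hop {u = u} {x} s≤r w (t , t≤m , W) with u ≟ᶠ x
  ... | yes refl = t , m≤n⇒m≤1+n t≤m , W
  ... | no u≢x   = suc t , s≤s t≤m , cons (u≢x , _ , s≤r , w) W

  walk⇒power-walk : ∀ m {u v k} → k ≤ m * r → Walk G u v k → ∃[ t ] (t ≤ m × Walk H u v t)
  walk⇒power-walk zero    z≤n (nil u) = 0 , z≤n , nil u
  walk⇒power-walk (suc m) {v = v} {k} k≤ w with k ≤? r
  ... | yes k≤r = prepend-hop k≤r w (0 , z≤n , nil v)
  ... | no  k≰r with m≤n⇒∃[o]m+o≡n (<⇒≤ (≰⇒> k≰r))
  ...   | o , refl with splitWalk r w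
  ...     | _ , w₁ , w₂ = prepend-hop ≤-refl w₁ (walk⇒power-walk m (+-cancelˡ-≤ r o (m * r) k≤) w₂)

-- An isometric path indexed by ℕ instead of Fin (suc ℓ); only q 0, …, q ℓ matter.
record IsGeodesic {n : ℕ} (K : Graph n) (ℓ : ℕ) (q : ℕ → Fin n) : Set where
  field
    edge    : ∀ k → k < ℓ → Adj K (q k) (q (suc k))
    minimal : ∀ k → Walk K (q 0) (q ℓ) k → ℓ ≤ k

module _ {n : ℕ} {K : Graph n} {ℓ : ℕ} {q : ℕ → Fin n} (geo : IsGeodesic K ℓ q) where

  open IsGeodesic geo

  segment : ∀ a c → c + a ≤ ℓ → Walk K (q a) (q (c + a)) c
  segment a zero    _  = nil (q a)
  segment a (suc c) le =
    cons (edge a (≤-trans (s≤s (m≤n+m a c)) le))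
         (subst (λ x → Walk K (q (suc a)) (q x) c) (+-suc c a)
                (segment (suc a) c (subst (_≤ ℓ) (≡-sym (+-suc c a)) le)))

  subwalk-length : ∀ a c {k} → c + a ≤ ℓ → Walk K (q a) (q (c + a)) k → c ≤ k
  subwalk-length a c {k} le w =
    +-cancelʳ-≤ rest c k (+-cancelˡ-≤ a (c + rest) (k + rest) (subst (_≤ a + (k + rest)) ℓ≡ long))
    where
    rest : ℕ
    rest = ℓ ∸ (c + a)
    ℓ≡ : ℓ ≡ a + (c + rest)
    ℓ≡ = begin
      ℓ                    ≡⟨ ≡-sym (m+[n∸m]≡n le) ⟩
      (c + a) + rest       ≡⟨ cong (_+ rest) (+-comm c a) ⟩
      (a + c) + rest       ≡⟨ +-assoc a c rest ⟩
      a + (c + rest)       ∎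
      where open ≡-Reasoning
    prefix : Walk K (q 0) (q a) a
    prefix = subst (λ x → Walk K (q 0) (q x) a) (+-identityʳ a)
                   (segment 0 a (≤-trans (≤-reflexive (+-identityʳ a)) (≤-trans (m≤n+m a c) le)))
    rest+c+a≡ℓ : rest + (c + a) ≡ ℓ
    rest+c+a≡ℓ = trans (+-comm rest (c + a)) (m+[n∸m]≡n le)
    suffix : Walk K (q (c + a)) (q ℓ) rest
    suffix = subst (λ x → Walk K (q (c + a)) (q x) rest) rest+c+a≡ℓ
                   (segment (c + a) rest (≤-reflexive rest+c+a≡ℓ))
    long : ℓ ≤ a + (k + rest)
    long = minimal _ (prefix ++ʷ (w ++ʷ suffix))

-- Indices beyond ℓ wrap around.
module _ {n ℓ : ℕ} (p : Fin (suc ℓ) → Fin n) where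

  extend : ℕ → Fin n
  extend k = p (k mod suc ℓ)

  extend-toℕ : ∀ x → extend (toℕ x) ≡ p x
  extend-toℕ x = cong p (toℕ-injective (trans (toℕ-fromℕ< _) (m<n⇒m%n≡m (toℕ<n x))))

  extend-edge : ∀ (K : Graph n) (i : Fin ℓ) →
                Adj K (p (inject₁ i)) (p (fsuc i)) → Adj K (extend (toℕ i)) (extend (suc (toℕ i)))
  extend-edge K i = subst₂ (Adj K) (≡-sym extend-i) (≡-sym (extend-toℕ (fsuc i)))
    where
    extend-i : extend (toℕ i) ≡ p (inject₁ i)
    extend-i = trans (cong extend (≡-sym (toℕ-inject₁ i))) (extend-toℕ (inject₁ i))

  isIsometricPath⇒isGeodesic : ∀ {K : Graph n} → IsIsometricPath K ℓ p → IsGeodesic K ℓ extend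
  isIsometricPath⇒isGeodesic {K} iso = record { edge = edge′ ; minimal = minimal′ }
    where
    edge′ : ∀ k → k < ℓ → Adj K (extend k) (extend (suc k))
    edge′ k k<ℓ = subst (λ x → Adj K (extend x) (extend (suc x))) (toℕ-fromℕ< k<ℓ)
                        (extend-edge K (fromℕ< k<ℓ) (adjacent (isPath iso) (fromℕ< k<ℓ)))
    minimal′ : ∀ k → Walk K (extend 0) (extend ℓ) k → ℓ ≤ k
    minimal′ k w = shortest iso k (subst₂ (λ u v → Walk K u v k) (extend-toℕ fzero) extend-ℓ w)
      where
      extend-ℓ : extend ℓ ≡ p (fromℕ ℓ)
      extend-ℓ = trans (cong extend (≡-sym (toℕ-fromℕ ℓ))) (extend-toℕ (fromℕ ℓ))

module _ {n : ℕ} (G : Graph n) {r : ℕ} (2≤r : 2 ≤ r) {ℓ : ℕ} {q : ℕ → Fin n}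
         (geo : IsGeodesic (power G r) ℓ q) where

  private
    H : Graph n
    H = power G r

  base-walk : ∀ a d → suc a + d < ℓ →
              Adj G (q a) (q (suc a)) → Adj G (q (suc a + d)) (q (suc (suc a + d))) →
              ∃[ k ] (k ≤ suc d * r × Walk G (q a) (q (suc (suc a + d))) k)
  base-walk a d b<ℓ eₐ e_b = close (power-walk⇒walk G r between)
    where
    between : Walk H (q (suc a)) (q (suc a + d)) d
    between = subst (λ x → Walk H (q (suc a)) (q x) d) (+-comm d (suc a))
                    (segment geo (suc a) d (≤-trans (≤-reflexive (+-comm d (suc a))) (<⇒≤ b<ℓ)))
    close : ∃[ k ] (k ≤ d * r × Walk G (q (suc a)) (q (suc a + d)) k) →
            ∃[ k ] (k ≤ suc d * r × Walk G (q a) (q (suc (suc a + d))) k)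
    close (k , k≤ , w) = suc (k + 1)
                       , ≤-trans (≤-reflexive (cong suc (+-comm k 1))) (+-mono-≤ 2≤r k≤)
                       , cons eₐ (w ++ʷ cons e_b (nil _))

  geodesic-no-two-base-edges :
    ∀ {a b} → a < b → b < ℓ → Adj G (q a) (q (suc a)) → Adj G (q b) (q (suc b)) → ⊥
  geodesic-no-two-base-edges {a} a<b b<ℓ eₐ e_b with m≤n⇒∃[o]m+o≡n a<b
  ... | d , refl with base-walk a d b<ℓ eₐ e_b
  ...   | _ , k≤ , w with walk⇒power-walk G r (suc d) k≤ w
  ...     | t , t≤d+1 , w′ = <-irrefl refl (≤-trans d+2≤t t≤d+1)
    where
    suc-b≡ : suc (suc a + d) ≡ suc (suc d) + a
    suc-b≡ = cong (λ x → suc (suc x)) (+-comm a d)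
    d+2≤t : suc (suc d) ≤ t
    d+2≤t = subwalk-length geo a (suc (suc d)) (subst (_≤ ℓ) suc-b≡ b<ℓ)
                           (subst (λ x → Walk H (q a) (q x) t) suc-b≡ w′)

  geodesic-base-edge-unique :
    ∀ {a b} → a < ℓ → b < ℓ → Adj G (q a) (q (suc a)) → Adj G (q b) (q (suc b)) → a ≡ b
  geodesic-base-edge-unique {a} {b} a<ℓ b<ℓ eₐ e_b with <-cmp a b
  ... | tri< a<b _ _ = ⊥-elim (geodesic-no-two-base-edges a<b b<ℓ eₐ e_b)
  ... | tri≈ _ a≡b _ = a≡b
  ... | tri> _ _ b<a = ⊥-elim (geodesic-no-two-base-edges b<a a<ℓ e_b eₐ)

lemma4p3 : ∀ {n} (G : Graph n) → Connected G → (r : ℕ) → 2 ≤ r →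
    ∀ (ℓ : ℕ) (p : Fin (ℕ.suc ℓ) → Fin n) → IsIsometricPath (power G r) ℓ p →
    ∀ (i j : Fin ℓ) → Adj G (p (inject₁ i)) (p (fsuc i)) → Adj G (p (inject₁ j)) (p (fsuc j)) → i ≡ j
lemma4p3 G _ r 2≤r ℓ p iso i j eᵢ eⱼ =
  toℕ-injective (geodesic-base-edge-unique G 2≤r (isIsometricPath⇒isGeodesic p iso)
                  (toℕ<n i) (toℕ<n j) (extend-edge p G i eᵢ) (extend-edge p G j eⱼ))
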